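{- Let $R$ be a consistent set of rooted triples with leaf set $L=L_R$. If the tree $\mathrm{Aho}(R)$ produced by the algorithm BUILD on $R$ is binary, then the closure $\operatorname{cl}(R)$ is strictly dense on $L$. Moreover, in this case $\mathrm{Aho}(R)$ is the unique phylogenetic tree on $L$ (up to isomorphism) that displays $R$, and hence it is a least resolved tree for $R$, i.e. a phylogenetic tree displaying $R$ with the minimum possible number of inner vertices.
   Context: A phylogenetic tree on a finite set $L$ is a rooted tree with leaf set $L$ in which no inner vertex has outdegree one. It is binary if every inner vertex has outdegree two. A rooted triple $(xy|z)$ on distinct $x,y,z$ (with leaf set $L_r=\{x,y,z\}$) is displayed by a phylogenetic tree $T$ if $x,y,z$ are leaves of $T$ and $\operatorname{lca}_T(x,y)$ is a proper descendant of $\operatorname{lca}_T(x,y,z)$; $\mathfrak{R}(T)$ denotes the set of triples displayed by $T$. For a triple set $R$, $L_R=\bigcup_{r\in R}L_r$; $R$ is consistent if some phylogenetic tree on $L_R$ displays all of $R$, and then $\operatorname{cl}(R)$ is the intersection of $\mathfrak{R}(T)$ over all phylogenetic trees $T$ on $L_R$ that display $R$. A triple set is strictly dense on $L$ if for every 3-element subset of $L$ it contains exactly one triple on those three leaves. For $S\subseteq L_R$, the Aho graph $[R,S]$ has vertex set $S$, and $x,y\in S$ are adjacent iff there is a triple $(xy|z)\in R$ with $z\in S$. BUILD$(R,S)$: if $|S|=1$ return the single vertex; otherwise compute $[R,S]$; if it is connected, report that $R$ is inconsistent; otherwise create a root whose children are the roots of the trees BUILD$(R,C)$ for the vertex sets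 $C$ of the connected components of $[R,S]$. $\mathrm{Aho}(R)$ is the tree returned by BUILD$(R,L_R)$ (which exists exactly when $R$ is consistent, and then displays $R$). -}

module Defs where

open import Data.Nat using (ℕ; zero; suc; _+_; _≤_)
open import Data.Fin using (Fin)
open import Data.List using (List; []; _∷_; length; lookup)
open import Data.List.Membership.Propositional using (_∈_)
open import Data.Maybe using (Maybe; just; nothing)
open import Data.Product using (Σ; ∃; _×_; _,_)
open import Data.Sum using (_⊎_)
open import Data.Unit using (⊤)
open import Relation.Binary.PropositionalEquality using (_≡_; _≢_)
open import Relation.Nullary using (¬_)
open import Function.Bundles using (_⇔_; _↔_)

-- Leaves are natural numbers.  A rooted triple (xy|z) on distinct leaves.

record Triple : Set where
  constructor mkTriple
  field
    x y z : ℕ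
    x≢y : x ≢ y
    x≢z : x ≢ z
    y≢z : y ≢ z
open Triple public

-- (xy|z) and (yx|z) are the same triple
_≈t_ : Triple → Triple → Set
r ≈t r' = (z r ≡ z r') × ((x r ≡ x r' × y r ≡ y r') ⊎ (x r ≡ y r' × y r ≡ x r'))

InLeaves : ℕ → Triple → Set
InLeaves w r = w ≡ x r ⊎ w ≡ y r ⊎ w ≡ z r

OnLeaves : Triple → ℕ → ℕ → ℕ → Set
OnLeaves r a b c = ∀ w → InLeaves w r ⇔ (w ≡ a ⊎ w ≡ b ⊎ w ≡ c)

-- L_R (as a list, possibly with repetitions; only membership matters)
leavesOf : List Triple → List ℕ
leavesOf [] = []
leavesOf (r ∷ R) = x r ∷ y r ∷ z r ∷ leavesOf R

-- Rooted trees (children as an unordered list, order irrelevant up to ≅)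

data Tree : Set where
  leaf : ℕ → Tree
  node : List Tree → Tree

-- vertices of a tree = positions
data Pos : Tree → Set where
  here  : ∀ {t} → Pos t
  there : ∀ {t ts} → t ∈ ts → Pos t → Pos (node ts)

subtree : ∀ {t} → Pos t → Tree
subtree {t} here = t
subtree (there _ p) = subtree p

labelAt : ∀ {t} → Pos t → Maybe ℕ
labelAt p with subtree p
... | leaf a = just a
... | node _ = nothing

-- Anc u v : u is an ancestor of v (or u = v), i.e. v is a descendant of u
data Anc : ∀ {t} → Pos t → Pos t → Set where
  anc-here  : ∀ {t} {p : Pos t} → Anc here p
  anc-there : ∀ {t ts} {m : t ∈ ts} {p q : Pos t} →
              Anc p q → Anc (there m p) (there m q)

data Child : ∀ {t} → Pos t → Pos t → Set where
  child-here  : ∀ {t ts} {m : t ∈ ts} → Child {node ts} here (there m here)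
  child-there : ∀ {t ts} {m : t ∈ ts} {p q : Pos t} →
                Child p q → Child (there m p) (there m q)

CommonAnc : ∀ {t} → Pos t → List ℕ → Set
CommonAnc {t} v X = ∀ a → a ∈ X → Σ (Pos t) λ p → labelAt p ≡ just a × Anc v p

IsLca : ∀ {t} → Pos t → List ℕ → Set
IsLca {t} v X = CommonAnc v X × (∀ (w : Pos t) → CommonAnc w X → Anc w v)

Displays : Tree → Triple → Set
Displays T r = Σ (Pos T) λ u → Σ (Pos T) λ v →
  IsLca u (x r ∷ y r ∷ []) × IsLca v (x r ∷ y r ∷ z r ∷ []) × Anc v u × u ≢ v

DisplaysAll : Tree → List Triple → Set
DisplaysAll T R = ∀ r → r ∈ R → Displays T r

NoDeg1 : Tree → Set
NoDeg1 (leaf _) = ⊤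
NoDeg1 (node ts) = 2 ≤ length ts

Bin : Tree → Set
Bin (leaf _) = ⊤
Bin (node ts) = length ts ≡ 2

IsPhylo : Tree → List ℕ → Set
IsPhylo T L =
  (∀ (p : Pos T) → NoDeg1 (subtree p)) ×
  (∀ a → a ∈ L ⇔ (Σ (Pos T) λ p → labelAt p ≡ just a)) ×
  (∀ a (p q : Pos T) → labelAt p ≡ just a → labelAt q ≡ just a → p ≡ q)

IsBinary : Tree → Set
IsBinary T = ∀ (p : Pos T) → Bin (subtree p)

_≅_ : Tree → Tree → Set
T ≅ T' = Σ (Pos T ↔ Pos T') λ φ → let open Function.Bundles.Inverse φ in
  (∀ p q → Child p q ⇔ Child (to p) (to q)) × (∀ p → labelAt p ≡ labelAt (to p))

mutual
  innerCount : Tree → ℕ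
  innerCount (leaf _) = 0
  innerCount (node ts) = suc (innerCounts ts)

  innerCounts : List Tree → ℕ
  innerCounts [] = 0
  innerCounts (t ∷ ts) = innerCount t + innerCounts ts

Consistent : List Triple → Set
Consistent R = Σ Tree λ T → IsPhylo T (leavesOf R) × DisplaysAll T R

InCl : List Triple → Triple → Set
InCl R r = ∀ T → IsPhylo T (leavesOf R) → DisplaysAll T R → Displays T r

StrictlyDense : (Triple → Set) → List ℕ → Set
StrictlyDense P L = ∀ a b c → a ∈ L → b ∈ L → c ∈ L →
  a ≢ b → a ≢ c → b ≢ c →
  (Σ Triple λ r → P r × OnLeaves r a b c) ×
  (∀ r r' → P r → P r' → OnLeaves r a b c → OnLeaves r' a b c → r ≈t r')

Adj : List Triple → List ℕ → ℕ → ℕ → Set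
Adj R S a b = a ∈ S × b ∈ S × Σ Triple λ r → r ∈ R ×
  ((a ≡ x r × b ≡ y r) ⊎ (a ≡ y r × b ≡ x r)) × z r ∈ S

data PathIn (R : List Triple) (S C : List ℕ) : ℕ → ℕ → Set where
  p-refl : ∀ {a} → PathIn R S C a a
  p-step : ∀ {a b c} → Adj R S a b → b ∈ C → PathIn R S C b c → PathIn R S C a c

Components : List Triple → List ℕ → List (List ℕ) → Set
Components R S Cs =
  (∀ (i : Fin (length Cs)) → Σ ℕ λ a → a ∈ lookup Cs i) ×
  (∀ a → a ∈ S ⇔ (Σ (Fin (length Cs)) λ i → a ∈ lookup Cs i)) ×
  (∀ (i j : Fin (length Cs)) a → a ∈ lookup Cs i → a ∈ lookup Cs j → i ≡ j) ×
  (∀ (i : Fin (length Cs)) a b → a ∈ lookup Cs i → b ∈ lookup Cs i →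
     PathIn R S (lookup Cs i) a b) ×
  (∀ (i j : Fin (length Cs)) a b → a ∈ lookup Cs i → b ∈ lookup Cs j →
     Adj R S a b → i ≡ j)

-- Build R S T : BUILD(R,S) returns T (children order immaterial).
-- No rule applies when [R,S] is connected with |S| ≥ 2 (inconsistency).
mutual
  data Build (R : List Triple) : List ℕ → Tree → Set where
    build-leaf : ∀ {S a} → a ∈ S → (∀ b → b ∈ S → b ≡ a) → Build R S (leaf a)
    build-node : ∀ {S Cs ts} → Components R S Cs → 2 ≤ length Cs →
                 BuildAll R Cs ts → Build R S (node ts)

  data BuildAll (R : List Triple) : List (List ℕ) → List Tree → Set where
    []  : BuildAll R [] []
    _∷_ : ∀ {C Cs t ts} → Build R C t → BuildAll R Cs ts → BuildAll R (C ∷ Cs) (t ∷ ts)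

IsAho : List Triple → Tree → Set
IsAho R T = Build R (leavesOf R) T

-- A tree with unique labels displays (xy|z) exactly when some vertex below the root has x and y but
-- not z among its leaves.  If BUILD returns a binary tree, every recursive call splits the Aho graph
-- [R,S] into exactly two components.  Let T′ be any phylogenetic tree on S displaying R.  Vertices
-- adjacent in [R,S] form the cherry of a triple displayed by T′, so they lie below the same child of
-- its root, and hence so does each component.  Every child contains a leaf and so meets a component,
-- and the root has at least two children; therefore the two components are exactly the leaf sets of
-- the two children, and by induction T′ is Aho(R) up to swapping children.  Thus Aho(R) is the only
-- tree displaying R, cl(R) is the set of triples it displays, and that set is strictly dense because
-- a binary tree resolves every three of its leaves.

module Submission where

open import Defs
open import Data.List using (List)
open import Data.Nat using (_≤_)
open import Data.Product using (_×_)

open import Data.Empty using (⊥-elim)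
open import Data.Fin using (Fin; zero; suc) renaming (_≟_ to _≟ᶠ_)
open import Data.Fin.Properties using (injective⇒≤; 0≢1+n)
open import Data.List using ([]; _∷_; _++_; length; lookup)
open import Data.List.Membership.Propositional using (_∈_)
open import Data.List.Membership.Propositional.Properties using (∈-lookup; ∈-++⁻; ∈-++⁺ˡ; ∈-++⁺ʳ)
open import Data.List.Relation.Unary.Any using (here; there; index)
open import Data.List.Relation.Unary.Any.Properties using (lookup-index)
open import Data.Maybe using (Maybe; just; nothing)
open import Data.Maybe.Properties using (just-injective)
open import Data.Nat using (ℕ; suc; _+_; z≤n; s≤s) renaming (_≟_ to _≟ℕ_)
open import Data.Nat.Properties using (+-comm; +-identityʳ; ≤-reflexive; ≤-antisym; ≤⇒≯)
open import Data.Product using (Σ; ∃; ∃₂; _,_; proj₁; proj₂)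
open import Data.Sum using (_⊎_; inj₁; inj₂; swap; map₂; assocʳ)
open import Data.Unit using (tt)
open import Function using (_∘_; id; Injective)
open import Function.Bundles using (_⇔_; mk⇔; mk↔ₛ′; Equivalence)
open import Relation.Binary.PropositionalEquality
open import Relation.Nullary using (¬_; Dec; yes; no)
open import Relation.Nullary.Decidable using (map′)
import Data.Sum as Sum

open Equivalence using (to; from)

-- Leaves and positions

labelOf : Tree → Maybe ℕ
labelOf (leaf a) = just a
labelOf (node _) = nothing

-- labelAt is defined by with on subtree, so labelAt (there m p) is not definitionally labelAt p.
labelAt≡labelOf : ∀ {t} (p : Pos t) → labelAt p ≡ labelOf (subtree p)
labelAt≡labelOf p with subtree p
... | leaf _ = refl
... | node _ = refl

labelAt-there : ∀ {t ts} (m : t ∈ ts) (p : Pos t) → labelAt (there m p) ≡ labelAt p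
labelAt-there m p = trans (labelAt≡labelOf (there m p)) (sym (labelAt≡labelOf p))

there-injective : ∀ {t ts} {m : t ∈ ts} {p q : Pos t} →
  _≡_ {A = Pos (node ts)} (there m p) (there m q) → p ≡ q
there-injective refl = refl

index-∈-lookup : ∀ {A : Set} (xs : List A) (k : Fin (length xs)) → index (∈-lookup {xs = xs} k) ≡ k
index-∈-lookup (_ ∷ _) zero = refl
index-∈-lookup (_ ∷ xs) (suc k) = cong suc (index-∈-lookup xs k)

childPos : ∀ {ts} (k : Fin (length ts)) → Pos (lookup ts k) → Pos (node ts)
childPos {ts} k = there (∈-lookup {xs = ts} k)

labelAt-childPos : ∀ {ts} (k : Fin (length ts)) (p : Pos (lookup ts k)) → labelAt (childPos {ts} k p) ≡ labelAt p
labelAt-childPos {ts} k = labelAt-there (∈-lookup {xs = ts} k)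

childIndex : ∀ {ts} → Pos (node ts) → Maybe (Fin (length ts))
childIndex here = nothing
childIndex (there m _) = just (index m)

infix 4 _∈ₜ_ _∈ₜ?_

data _∈ₜ_ (a : ℕ) : Tree → Set where
  in-leaf : a ∈ₜ leaf a
  in-node : ∀ {ts} (k : Fin (length ts)) → a ∈ₜ lookup ts k → a ∈ₜ node ts

UniqueLabels : Tree → Set
UniqueLabels t = ∀ a (p q : Pos t) → labelAt p ≡ just a → labelAt q ≡ just a → p ≡ q

NoUnary : Tree → Set
NoUnary t = ∀ (p : Pos t) → NoDeg1 (subtree p)

∈ₜ⇒labelled : ∀ {a t} → a ∈ₜ t → ∃ λ (p : Pos t) → labelAt p ≡ just a
∈ₜ⇒labelled in-leaf = here , refl
∈ₜ⇒labelled {t = node ts} (in-node k a∈) =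
  let p , e = ∈ₜ⇒labelled a∈ in childPos k p , trans (labelAt-childPos {ts} k p) e

labelled⇒∈ₜ : ∀ {a t} (p : Pos t) → labelAt p ≡ just a → a ∈ₜ t
labelled⇒∈ₜ {t = leaf _} here refl = in-leaf
labelled⇒∈ₜ {t = node _} here ()
labelled⇒∈ₜ {a} (there m p) e =
  in-node (index m) (subst (a ∈ₜ_) (lookup-index m) (labelled⇒∈ₜ p (trans (sym (labelAt-there m p)) e)))

child-unique : ∀ {ts a} → UniqueLabels (node ts) → (k l : Fin (length ts)) →
  a ∈ₜ lookup ts k → a ∈ₜ lookup ts l → k ≡ l
child-unique {ts} {a} U k l a∈k a∈l = begin
  k                             ≡⟨ index-∈-lookup ts k ⟨
  index (∈-lookup {xs = ts} k)  ≡⟨ just-injective (cong childIndex positions≡) ⟩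
  index (∈-lookup {xs = ts} l)  ≡⟨ index-∈-lookup ts l ⟩
  l                             ∎
  where
  open ≡-Reasoning
  p : Pos (lookup ts k)
  p = proj₁ (∈ₜ⇒labelled a∈k)
  q : Pos (lookup ts l)
  q = proj₁ (∈ₜ⇒labelled a∈l)
  positions≡ : childPos k p ≡ childPos l q
  positions≡ = U a _ _ (trans (labelAt-childPos {ts} k p) (proj₂ (∈ₜ⇒labelled a∈k)))
                       (trans (labelAt-childPos {ts} l q) (proj₂ (∈ₜ⇒labelled a∈l)))

UniqueLabels-child : ∀ {ts} → UniqueLabels (node ts) → (k : Fin (length ts)) → UniqueLabels (lookup ts k)
UniqueLabels-child {ts} U k a p q ep eq = there-injective
  (U a (childPos k p) (childPos k q) (trans (labelAt-childPos {ts} k p) ep) (trans (labelAt-childPos {ts} k q) eq))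

NoUnary-child : ∀ {ts} → NoUnary (node ts) → (k : Fin (length ts)) → NoUnary (lookup ts k)
NoUnary-child nd k p = nd (childPos k p)

NoUnary⇒leaf : ∀ t → NoUnary t → ∃ λ a → a ∈ₜ t
NoUnary⇒leaf (leaf a) _ = a , in-leaf
NoUnary⇒leaf (node []) nd with nd here
... | ()
NoUnary⇒leaf (node (u ∷ us)) nd =
  let a , a∈u = NoUnary⇒leaf u (NoUnary-child nd zero) in a , in-node zero a∈u

_∈ₜ?_ : ∀ a t → Dec (a ∈ₜ t)
∈-children? : ∀ a ts → Dec (∃ λ (k : Fin (length ts)) → a ∈ₜ lookup ts k)
a ∈ₜ? leaf b = map′ (λ { refl → in-leaf }) (λ { in-leaf → refl }) (a ≟ℕ b)
a ∈ₜ? node ts = map′ (λ (k , a∈) → in-node k a∈) (λ { (in-node k a∈) → k , a∈ }) (∈-children? a ts)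
∈-children? a [] = no λ ()
∈-children? a (t ∷ ts) with a ∈ₜ? t | ∈-children? a ts
... | yes a∈t | _ = yes (zero , a∈t)
... | no _ | yes (k , a∈) = yes (suc k , a∈)
... | no a∉t | no a∉ts = no λ { (zero , a∈) → a∉t a∈ ; (suc k , a∈) → a∉ts (k , a∈) }

-- Lowest common ancestors and displayed triples

Anc-refl : ∀ {t} (p : Pos t) → Anc p p
Anc-refl here = anc-here
Anc-refl (there m p) = anc-there (Anc-refl p)

Anc-trans : ∀ {t} {p q r : Pos t} → Anc p q → Anc q r → Anc p r
Anc-trans anc-here _ = anc-here
Anc-trans (anc-there p≤q) (anc-there q≤r) = anc-there (Anc-trans p≤q q≤r)

Anc-antisym : ∀ {t} {p q : Pos t} → Anc p q → Anc q p → p ≡ q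
Anc-antisym anc-here anc-here = refl
Anc-antisym (anc-there p≤q) (anc-there q≤p) = cong (there _) (Anc-antisym p≤q q≤p)

data SameMember {ts : List Tree} : ∀ {u v : Tree} → u ∈ ts → v ∈ ts → Set where
  same      : ∀ {u} (m : u ∈ ts) → SameMember m m
  different : ∀ {u v} {m : u ∈ ts} {n : v ∈ ts} → SameMember m n

sameMember? : ∀ {ts : List Tree} {u v} (m : u ∈ ts) (n : v ∈ ts) → SameMember m n
sameMember? (here refl) (here refl) = same _
sameMember? (here refl) (there _) = different
sameMember? (there _) (here refl) = different
sameMember? (there m) (there n) with sameMember? m n
... | same _ = same _
... | different = different

sameMember?-refl : ∀ {ts : List Tree} {u} (m : u ∈ ts) → sameMember? m m ≡ same m
sameMember?-refl (here refl) = refl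
sameMember?-refl (there m) rewrite sameMember?-refl m = refl

meet : ∀ {t} → Pos t → Pos t → Pos t
meet-there : ∀ {ts u v} {m : u ∈ ts} {n : v ∈ ts} → SameMember m n → Pos u → Pos v → Pos (node ts)
meet here q = here
meet (there m p) here = here
meet (there m p) (there n q) = meet-there (sameMember? m n) p q
meet-there (same m) p q = there m (meet p q)
meet-there different p q = here

meet-ancˡ : ∀ {t} (p q : Pos t) → Anc (meet p q) p
meet-there-ancˡ : ∀ {ts u v} {m : u ∈ ts} {n : v ∈ ts} (s : SameMember m n) (p : Pos u) (q : Pos v) →
  Anc (meet-there s p q) (there m p)
meet-ancˡ here q = anc-here
meet-ancˡ (there m p) here = anc-here
meet-ancˡ (there m p) (there n q) = meet-there-ancˡ (sameMember? m n) p q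
meet-there-ancˡ (same m) p q = anc-there (meet-ancˡ p q)
meet-there-ancˡ different p q = anc-here

meet-ancʳ : ∀ {t} (p q : Pos t) → Anc (meet p q) q
meet-there-ancʳ : ∀ {ts u v} {m : u ∈ ts} {n : v ∈ ts} (s : SameMember m n) (p : Pos u) (q : Pos v) →
  Anc (meet-there s p q) (there n q)
meet-ancʳ here q = anc-here
meet-ancʳ (there m p) here = anc-here
meet-ancʳ (there m p) (there n q) = meet-there-ancʳ (sameMember? m n) p q
meet-there-ancʳ (same m) p q = anc-there (meet-ancʳ p q)
meet-there-ancʳ different p q = anc-here

meet-greatest : ∀ {t} {w p q : Pos t} → Anc w p → Anc w q → Anc w (meet p q)
meet-greatest anc-here _ = anc-here
meet-greatest (anc-there {m = m} w≤p) (anc-there w≤q) rewrite sameMember?-refl m =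
  anc-there (meet-greatest w≤p w≤q)

descendant⇒∈ₜ : ∀ {t a} (q p : Pos t) → Anc q p → labelAt p ≡ just a → a ∈ₜ subtree q
descendant⇒∈ₜ here p _ e = labelled⇒∈ₜ p e
descendant⇒∈ₜ (there m q) (there .m p) (anc-there q≤p) e =
  descendant⇒∈ₜ q p q≤p (trans (sym (labelAt-there m p)) e)

∈ₜ⇒descendant : ∀ {t a} (q : Pos t) → a ∈ₜ subtree q → ∃ λ (p : Pos t) → labelAt p ≡ just a × Anc q p
∈ₜ⇒descendant here a∈ = let p , e = ∈ₜ⇒labelled a∈ in p , e , anc-here
∈ₜ⇒descendant (there m q) a∈ =
  let p , e , q≤p = ∈ₜ⇒descendant q a∈ in there m p , trans (labelAt-there m p) e , anc-there q≤p

∈ₜ-subtree : ∀ {t a} (q : Pos t) → a ∈ₜ subtree q → a ∈ₜ t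
∈ₜ-subtree q a∈ = let p , e , _ = ∈ₜ⇒descendant q a∈ in labelled⇒∈ₜ p e

CommonAnc⇒∈ₜ : ∀ {t X a} (w : Pos t) → CommonAnc w X → a ∈ X → a ∈ₜ subtree w
CommonAnc⇒∈ₜ w common a∈X = let p , e , w≤p = common _ a∈X in descendant⇒∈ₜ w p w≤p e

IsLca-leaf : ∀ {t a} {p : Pos t} → UniqueLabels t → labelAt p ≡ just a → IsLca p (a ∷ [])
IsLca-leaf {a = a} {p} U e = (λ { _ (here refl) → p , e , Anc-refl p }) , lowest
  where
  lowest : ∀ w → CommonAnc w (a ∷ []) → Anc w p
  lowest w common with common _ (here refl)
  ... | p′ , e′ , w≤p′ rewrite U _ p′ p e′ e = w≤p′

IsLca-meet : ∀ {t X c} {u p : Pos t} → UniqueLabels t → IsLca u X → labelAt p ≡ just c →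
  IsLca (meet u p) (X ++ c ∷ [])
IsLca-meet {X = X} {c} {u} {p} U (u-common , u-lowest) e = common , lowest
  where
  common : CommonAnc (meet u p) (X ++ c ∷ [])
  common a a∈ with ∈-++⁻ X a∈
  ... | inj₁ a∈X = let q , e′ , u≤q = u-common a a∈X in q , e′ , Anc-trans (meet-ancˡ u p) u≤q
  ... | inj₂ (here refl) = p , e , meet-ancʳ u p
  lowest : ∀ w → CommonAnc w (X ++ c ∷ []) → Anc w (meet u p)
  lowest w w-common with w-common _ (∈-++⁺ʳ X (here refl))
  ... | p′ , e′ , w≤p′ rewrite U _ p′ p e′ e =
    meet-greatest (u-lowest w (λ a a∈X → w-common a (∈-++⁺ˡ a∈X))) w≤p′

data Separates : Tree → ℕ → ℕ → ℕ → Set where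
  sep-here  : ∀ {ts a b c} (k : Fin (length ts)) →
              a ∈ₜ lookup ts k → b ∈ₜ lookup ts k → ¬ c ∈ₜ lookup ts k → Separates (node ts) a b c
  sep-there : ∀ {ts a b c} (k : Fin (length ts)) →
              Separates (lookup ts k) a b c → Separates (node ts) a b c

Separates-∈ₜ : ∀ {t a b c} → Separates t a b c → a ∈ₜ t
Separates-∈ₜ (sep-here k a∈ _ _) = in-node k a∈
Separates-∈ₜ (sep-there k s) = in-node k (Separates-∈ₜ s)

Separates-swap : ∀ {t a b c} → Separates t a b c → Separates t b a c
Separates-swap (sep-here k a∈ b∈ c∉) = sep-here k b∈ a∈ c∉
Separates-swap (sep-there k s) = sep-there k (Separates-swap s)

cluster⇒Separates : ∀ {t a b c} (q : Pos t) →
  a ∈ₜ subtree q → b ∈ₜ subtree q → ¬ c ∈ₜ subtree q → c ∈ₜ t → Separates t a b c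
cluster⇒Separates here a∈ b∈ c∉ c∈t = ⊥-elim (c∉ c∈t)
cluster⇒Separates {node ts} {a} {b} {c} (there {t = u} m q) a∈ b∈ c∉ c∈t with c ∈ₜ? u
... | yes c∈u =
  sep-there (index m) (subst (λ v → Separates v a b c) (lookup-index m) (cluster⇒Separates q a∈ b∈ c∉ c∈u))
... | no c∉u =
  sep-here (index m) (toChild (∈ₜ-subtree q a∈)) (toChild (∈ₜ-subtree q b∈))
    (c∉u ∘ subst (c ∈ₜ_) (sym (lookup-index m)))
  where
  toChild : ∀ {d} → d ∈ₜ u → d ∈ₜ lookup ts (index m)
  toChild = subst (_ ∈ₜ_) (lookup-index m)

Separates⇒cluster : ∀ {t a b c} → Separates t a b c →
  ∃ λ (q : Pos t) → a ∈ₜ subtree q × b ∈ₜ subtree q × ¬ c ∈ₜ subtree q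
Separates⇒cluster (sep-here k a∈ b∈ c∉) = childPos k here , a∈ , b∈ , c∉
Separates⇒cluster (sep-there k s) =
  let q , inside = Separates⇒cluster s in childPos k q , inside

Displays⇒Separates : ∀ {T} r → Displays T r → Separates T (x r) (y r) (z r)
Displays⇒Separates r (u , v , (u-common , _) , (v-common , v-lowest) , v≤u , u≢v) =
  cluster⇒Separates u (CommonAnc⇒∈ₜ u u-common (here refl)) (CommonAnc⇒∈ₜ u u-common (there (here refl)))
    z∉u (∈ₜ-subtree v (CommonAnc⇒∈ₜ v v-common (there (there (here refl)))))
  where
  z∉u : ¬ z r ∈ₜ subtree u
  z∉u z∈u = u≢v (Anc-antisym (v-lowest u u-common′) v≤u)
    where
    u-common′ : CommonAnc u (x r ∷ y r ∷ z r ∷ [])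
    u-common′ _ (here refl) = u-common _ (here refl)
    u-common′ _ (there (here refl)) = u-common _ (there (here refl))
    u-common′ _ (there (there (here refl))) = ∈ₜ⇒descendant u z∈u

Separates⇒Displays : ∀ {T} r → UniqueLabels T → x r ∈ₜ T → y r ∈ₜ T → z r ∈ₜ T →
  Separates T (x r) (y r) (z r) → Displays T r
Separates⇒Displays {T} r U x∈ y∈ z∈ s = u , v , u-lca , IsLca-meet U u-lca ez , meet-ancˡ u pz , u≢v
  where
  px py pz u v : Pos T
  px = proj₁ (∈ₜ⇒labelled x∈)
  py = proj₁ (∈ₜ⇒labelled y∈)
  pz = proj₁ (∈ₜ⇒labelled z∈)
  u = meet px py
  v = meet u pz
  ez : labelAt pz ≡ just (z r)
  ez = proj₂ (∈ₜ⇒labelled z∈)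
  u-lca : IsLca u (x r ∷ y r ∷ [])
  u-lca = IsLca-meet {u = px} {py} U (IsLca-leaf U (proj₂ (∈ₜ⇒labelled x∈))) (proj₂ (∈ₜ⇒labelled y∈))
  u≢v : u ≢ v
  u≢v u≡v with Separates⇒cluster s
  ... | q , x∈q , y∈q , z∉q = z∉q (descendant⇒∈ₜ q pz (Anc-trans q≤u u≤z) ez)
    where
    q≤u : Anc q u
    q≤u = proj₂ u-lca q λ
      { _ (here refl) → ∈ₜ⇒descendant q x∈q
      ; _ (there (here refl)) → ∈ₜ⇒descendant q y∈q
      }
    u≤z : Anc u pz
    u≤z = subst (λ w → Anc w pz) (sym u≡v) (meet-ancʳ u pz)

-- Isomorphism of binary trees

infix 4 _≅ᵇ_

data _≅ᵇ_ : Tree → Tree → Set where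
  ≅ᵇ-leaf : ∀ {a} → leaf a ≅ᵇ leaf a
  ≅ᵇ-node : ∀ {t₁ t₂ u₁ u₂} → t₁ ≅ᵇ u₁ → t₂ ≅ᵇ u₂ → node (t₁ ∷ t₂ ∷ []) ≅ᵇ node (u₁ ∷ u₂ ∷ [])
  ≅ᵇ-swap : ∀ {t₁ t₂ u₁ u₂} → t₁ ≅ᵇ u₂ → t₂ ≅ᵇ u₁ → node (t₁ ∷ t₂ ∷ []) ≅ᵇ node (u₁ ∷ u₂ ∷ [])

≅ᵇ-sym : ∀ {t u} → t ≅ᵇ u → u ≅ᵇ t
≅ᵇ-sym ≅ᵇ-leaf = ≅ᵇ-leaf
≅ᵇ-sym (≅ᵇ-node s₁ s₂) = ≅ᵇ-node (≅ᵇ-sym s₁) (≅ᵇ-sym s₂)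
≅ᵇ-sym (≅ᵇ-swap s₁ s₂) = ≅ᵇ-swap (≅ᵇ-sym s₂) (≅ᵇ-sym s₁)

≅ᵇ-sym-involutive : ∀ {t u} (s : t ≅ᵇ u) → ≅ᵇ-sym (≅ᵇ-sym s) ≡ s
≅ᵇ-sym-involutive ≅ᵇ-leaf = refl
≅ᵇ-sym-involutive (≅ᵇ-node s₁ s₂) = cong₂ ≅ᵇ-node (≅ᵇ-sym-involutive s₁) (≅ᵇ-sym-involutive s₂)
≅ᵇ-sym-involutive (≅ᵇ-swap s₁ s₂) = cong₂ ≅ᵇ-swap (≅ᵇ-sym-involutive s₁) (≅ᵇ-sym-involutive s₂)

≅ᵇ-pos : ∀ {t u} → t ≅ᵇ u → Pos t → Pos u
≅ᵇ-pos s here = here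
≅ᵇ-pos (≅ᵇ-node s₁ _) (there (here refl) p) = there (here refl) (≅ᵇ-pos s₁ p)
≅ᵇ-pos (≅ᵇ-node _ s₂) (there (there (here refl)) p) = there (there (here refl)) (≅ᵇ-pos s₂ p)
≅ᵇ-pos (≅ᵇ-swap s₁ _) (there (here refl) p) = there (there (here refl)) (≅ᵇ-pos s₁ p)
≅ᵇ-pos (≅ᵇ-swap _ s₂) (there (there (here refl)) p) = there (here refl) (≅ᵇ-pos s₂ p)

≅ᵇ-pos-inverse : ∀ {t u} (s : t ≅ᵇ u) (p : Pos t) → ≅ᵇ-pos (≅ᵇ-sym s) (≅ᵇ-pos s p) ≡ p
≅ᵇ-pos-inverse s here = refl
≅ᵇ-pos-inverse (≅ᵇ-node s₁ _) (there (here refl) p) = cong (there _) (≅ᵇ-pos-inverse s₁ p)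
≅ᵇ-pos-inverse (≅ᵇ-node _ s₂) (there (there (here refl)) p) = cong (there _) (≅ᵇ-pos-inverse s₂ p)
≅ᵇ-pos-inverse (≅ᵇ-swap s₁ _) (there (here refl) p) = cong (there _) (≅ᵇ-pos-inverse s₁ p)
≅ᵇ-pos-inverse (≅ᵇ-swap _ s₂) (there (there (here refl)) p) = cong (there _) (≅ᵇ-pos-inverse s₂ p)

≅ᵇ-pos-inverseʳ : ∀ {t u} (s : t ≅ᵇ u) (q : Pos u) → ≅ᵇ-pos s (≅ᵇ-pos (≅ᵇ-sym s) q) ≡ q
≅ᵇ-pos-inverseʳ s q =
  subst (λ s′ → ≅ᵇ-pos s′ (≅ᵇ-pos (≅ᵇ-sym s) q) ≡ q) (≅ᵇ-sym-involutive s) (≅ᵇ-pos-inverse (≅ᵇ-sym s) q)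

≅ᵇ-Child : ∀ {t u} (s : t ≅ᵇ u) {p q : Pos t} → Child p q → Child (≅ᵇ-pos s p) (≅ᵇ-pos s q)
≅ᵇ-Child (≅ᵇ-node _ _) (child-here {m = here refl}) = child-here
≅ᵇ-Child (≅ᵇ-node _ _) (child-here {m = there (here refl)}) = child-here
≅ᵇ-Child (≅ᵇ-swap _ _) (child-here {m = here refl}) = child-here
≅ᵇ-Child (≅ᵇ-swap _ _) (child-here {m = there (here refl)}) = child-here
≅ᵇ-Child (≅ᵇ-node s₁ _) (child-there {m = here refl} c) = child-there (≅ᵇ-Child s₁ c)
≅ᵇ-Child (≅ᵇ-node _ s₂) (child-there {m = there (here refl)} c) = child-there (≅ᵇ-Child s₂ c)
≅ᵇ-Child (≅ᵇ-swap s₁ _) (child-there {m = here refl} c) = child-there (≅ᵇ-Child s₁ c)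
≅ᵇ-Child (≅ᵇ-swap _ s₂) (child-there {m = there (here refl)} c) = child-there (≅ᵇ-Child s₂ c)

≅ᵇ-labelOf : ∀ {t u} (s : t ≅ᵇ u) (p : Pos t) → labelOf (subtree p) ≡ labelOf (subtree (≅ᵇ-pos s p))
≅ᵇ-labelOf ≅ᵇ-leaf here = refl
≅ᵇ-labelOf (≅ᵇ-node _ _) here = refl
≅ᵇ-labelOf (≅ᵇ-swap _ _) here = refl
≅ᵇ-labelOf (≅ᵇ-node s₁ _) (there (here refl) p) = ≅ᵇ-labelOf s₁ p
≅ᵇ-labelOf (≅ᵇ-node _ s₂) (there (there (here refl)) p) = ≅ᵇ-labelOf s₂ p
≅ᵇ-labelOf (≅ᵇ-swap s₁ _) (there (here refl) p) = ≅ᵇ-labelOf s₁ p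
≅ᵇ-labelOf (≅ᵇ-swap _ s₂) (there (there (here refl)) p) = ≅ᵇ-labelOf s₂ p

≅ᵇ⇒≅ : ∀ {t u} → t ≅ᵇ u → t ≅ u
≅ᵇ⇒≅ s =
  mk↔ₛ′ (≅ᵇ-pos s) (≅ᵇ-pos (≅ᵇ-sym s)) (≅ᵇ-pos-inverseʳ s) (≅ᵇ-pos-inverse s) ,
  (λ p q → mk⇔ (≅ᵇ-Child s)
    (λ c → subst₂ Child (≅ᵇ-pos-inverse s p) (≅ᵇ-pos-inverse s q) (≅ᵇ-Child (≅ᵇ-sym s) c))) ,
  (λ p → trans (labelAt≡labelOf p) (trans (≅ᵇ-labelOf s p) (sym (labelAt≡labelOf (≅ᵇ-pos s p)))))

innerCount-node₂ : ∀ t₁ t₂ → innerCount (node (t₁ ∷ t₂ ∷ [])) ≡ suc (innerCount t₁ + innerCount t₂)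
innerCount-node₂ t₁ t₂ = cong (λ n → suc (innerCount t₁ + n)) (+-identityʳ (innerCount t₂))

innerCount-≅ᵇ : ∀ {t u} → t ≅ᵇ u → innerCount t ≡ innerCount u
innerCount-≅ᵇ ≅ᵇ-leaf = refl
innerCount-≅ᵇ (≅ᵇ-node {t₁} {t₂} {u₁} {u₂} s₁ s₂) = begin
  innerCount (node (t₁ ∷ t₂ ∷ []))   ≡⟨ innerCount-node₂ t₁ t₂ ⟩
  suc (innerCount t₁ + innerCount t₂) ≡⟨ cong₂ (λ m n → suc (m + n)) (innerCount-≅ᵇ s₁) (innerCount-≅ᵇ s₂) ⟩
  suc (innerCount u₁ + innerCount u₂) ≡⟨ innerCount-node₂ u₁ u₂ ⟨
  innerCount (node (u₁ ∷ u₂ ∷ []))   ∎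
  where open ≡-Reasoning
innerCount-≅ᵇ (≅ᵇ-swap {t₁} {t₂} {u₁} {u₂} s₁ s₂) = begin
  innerCount (node (t₁ ∷ t₂ ∷ []))   ≡⟨ innerCount-node₂ t₁ t₂ ⟩
  suc (innerCount t₁ + innerCount t₂) ≡⟨ cong₂ (λ m n → suc (m + n)) (innerCount-≅ᵇ s₁) (innerCount-≅ᵇ s₂) ⟩
  suc (innerCount u₂ + innerCount u₁) ≡⟨ cong suc (+-comm (innerCount u₂) (innerCount u₁)) ⟩
  suc (innerCount u₁ + innerCount u₂) ≡⟨ innerCount-node₂ u₁ u₂ ⟨
  innerCount (node (u₁ ∷ u₂ ∷ []))   ∎
  where open ≡-Reasoning

≅ᵇ-∈ₜ : ∀ {t u a} → t ≅ᵇ u → a ∈ₜ t → a ∈ₜ u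
≅ᵇ-∈ₜ ≅ᵇ-leaf a∈ = a∈
≅ᵇ-∈ₜ (≅ᵇ-node s₁ _) (in-node zero a∈) = in-node zero (≅ᵇ-∈ₜ s₁ a∈)
≅ᵇ-∈ₜ (≅ᵇ-node _ s₂) (in-node (suc zero) a∈) = in-node (suc zero) (≅ᵇ-∈ₜ s₂ a∈)
≅ᵇ-∈ₜ (≅ᵇ-swap s₁ _) (in-node zero a∈) = in-node (suc zero) (≅ᵇ-∈ₜ s₁ a∈)
≅ᵇ-∈ₜ (≅ᵇ-swap _ s₂) (in-node (suc zero) a∈) = in-node zero (≅ᵇ-∈ₜ s₂ a∈)

≅ᵇ-∉ₜ : ∀ {t u a} → t ≅ᵇ u → ¬ a ∈ₜ t → ¬ a ∈ₜ u
≅ᵇ-∉ₜ s a∉ a∈ = a∉ (≅ᵇ-∈ₜ (≅ᵇ-sym s) a∈)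

≅ᵇ-Separates : ∀ {t u a b c} → t ≅ᵇ u → Separates t a b c → Separates u a b c
≅ᵇ-Separates (≅ᵇ-node s₁ _) (sep-here zero a∈ b∈ c∉) =
  sep-here zero (≅ᵇ-∈ₜ s₁ a∈) (≅ᵇ-∈ₜ s₁ b∈) (≅ᵇ-∉ₜ s₁ c∉)
≅ᵇ-Separates (≅ᵇ-node _ s₂) (sep-here (suc zero) a∈ b∈ c∉) =
  sep-here (suc zero) (≅ᵇ-∈ₜ s₂ a∈) (≅ᵇ-∈ₜ s₂ b∈) (≅ᵇ-∉ₜ s₂ c∉)
≅ᵇ-Separates (≅ᵇ-swap s₁ _) (sep-here zero a∈ b∈ c∉) =
  sep-here (suc zero) (≅ᵇ-∈ₜ s₁ a∈) (≅ᵇ-∈ₜ s₁ b∈) (≅ᵇ-∉ₜ s₁ c∉)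
≅ᵇ-Separates (≅ᵇ-swap _ s₂) (sep-here (suc zero) a∈ b∈ c∉) =
  sep-here zero (≅ᵇ-∈ₜ s₂ a∈) (≅ᵇ-∈ₜ s₂ b∈) (≅ᵇ-∉ₜ s₂ c∉)
≅ᵇ-Separates (≅ᵇ-node s₁ _) (sep-there zero s) = sep-there zero (≅ᵇ-Separates s₁ s)
≅ᵇ-Separates (≅ᵇ-node _ s₂) (sep-there (suc zero) s) = sep-there (suc zero) (≅ᵇ-Separates s₂ s)
≅ᵇ-Separates (≅ᵇ-swap s₁ _) (sep-there zero s) = sep-there (suc zero) (≅ᵇ-Separates s₁ s)
≅ᵇ-Separates (≅ᵇ-swap _ s₂) (sep-there (suc zero) s) = sep-there zero (≅ᵇ-Separates s₂ s)

-- BUILD with binary output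

data Binary : Tree → Set where
  leaf : ∀ {a} → Binary (leaf a)
  node : ∀ {t₁ t₂} → Binary t₁ → Binary t₂ → Binary (node (t₁ ∷ t₂ ∷ []))

IsBinary⇒Binary : ∀ t → IsBinary t → Binary t
IsBinary⇒Binary (leaf _) _ = leaf
IsBinary⇒Binary (node (t₁ ∷ t₂ ∷ [])) bin =
  node (IsBinary⇒Binary t₁ (λ p → bin (there (here refl) p)))
       (IsBinary⇒Binary t₂ (λ p → bin (there (there (here refl)) p)))
IsBinary⇒Binary (node []) bin with bin here
... | ()
IsBinary⇒Binary (node (_ ∷ [])) bin with bin here
... | ()
IsBinary⇒Binary (node (_ ∷ _ ∷ _ ∷ _)) bin with bin here
... | ()

data BinaryBuild (R : List Triple) : List ℕ → Tree → Set where
  leaf : ∀ {S a} → a ∈ S → (∀ b → b ∈ S → b ≡ a) → BinaryBuild R S (leaf a)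
  node : ∀ {S C₁ C₂ t₁ t₂} → Components R S (C₁ ∷ C₂ ∷ []) →
         BinaryBuild R C₁ t₁ → BinaryBuild R C₂ t₂ → BinaryBuild R S (node (t₁ ∷ t₂ ∷ []))

Build⇒BinaryBuild : ∀ {R S T} → Build R S T → Binary T → BinaryBuild R S T
Build⇒BinaryBuild (build-leaf a∈S single) leaf = leaf a∈S single
Build⇒BinaryBuild (build-node comps _ (b₁ ∷ b₂ ∷ [])) (node bin₁ bin₂) =
  node comps (Build⇒BinaryBuild b₁ bin₁) (Build⇒BinaryBuild b₂ bin₂)

record PhyloDisplaying (R : List Triple) (S : List ℕ) (t : Tree) : Set where
  field
    noUnary   : NoUnary t
    unique    : UniqueLabels t
    leaves⁺   : ∀ {a} → a ∈ S → a ∈ₜ t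
    leaves⁻   : ∀ {a} → a ∈ₜ t → a ∈ S
    separates : ∀ {r} → r ∈ R → x r ∈ S → y r ∈ S → z r ∈ S → Separates t (x r) (y r) (z r)

open PhyloDisplaying

∈ₜ-leaf : ∀ {a b} → a ∈ₜ leaf b → a ≡ b
∈ₜ-leaf in-leaf = refl

UniqueLabels-node₂ : ∀ {t₁ t₂} → UniqueLabels t₁ → UniqueLabels t₂ → (∀ {a} → a ∈ₜ t₁ → ¬ a ∈ₜ t₂) →
  UniqueLabels (node (t₁ ∷ t₂ ∷ []))
UniqueLabels-node₂ U₁ U₂ disjoint a here _ () _
UniqueLabels-node₂ U₁ U₂ disjoint a (there _ _) here _ ()
UniqueLabels-node₂ U₁ U₂ disjoint a (there m@(here refl) p) (there (here refl) q) ep eq =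
  cong (there m) (U₁ a p q (trans (sym (labelAt-there m p)) ep) (trans (sym (labelAt-there m q)) eq))
UniqueLabels-node₂ U₁ U₂ disjoint a (there m@(there (here refl)) p) (there (there (here refl)) q) ep eq =
  cong (there m) (U₂ a p q (trans (sym (labelAt-there m p)) ep) (trans (sym (labelAt-there m q)) eq))
UniqueLabels-node₂ U₁ U₂ disjoint a (there m@(here refl) p) (there n@(there (here refl)) q) ep eq =
  ⊥-elim (disjoint (labelled⇒∈ₜ p (trans (sym (labelAt-there m p)) ep))
                   (labelled⇒∈ₜ q (trans (sym (labelAt-there n q)) eq)))
UniqueLabels-node₂ U₁ U₂ disjoint a (there m@(there (here refl)) p) (there n@(here refl) q) ep eq =
  ⊥-elim (disjoint (labelled⇒∈ₜ q (trans (sym (labelAt-there n q)) eq))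
                   (labelled⇒∈ₜ p (trans (sym (labelAt-there m p)) ep)))

BinaryBuild⇒PhyloDisplaying : ∀ {R S T} → BinaryBuild R S T → PhyloDisplaying R S T
BinaryBuild⇒PhyloDisplaying (leaf a∈S single) = record
  { noUnary = λ { here → tt }
  ; unique = λ { _ here here _ _ → refl }
  ; leaves⁺ = λ b∈S → subst (_∈ₜ leaf _) (sym (single _ b∈S)) in-leaf
  ; leaves⁻ = λ { in-leaf → a∈S }
  ; separates = λ {r} _ x∈ y∈ _ → ⊥-elim (x≢y r (trans (single _ x∈) (sym (single _ y∈))))
  }
BinaryBuild⇒PhyloDisplaying {R} {S} (node {C₁ = C₁} {C₂} {t₁} {t₂} (_ , cover , disjoint , _ , closed) b₁ b₂) =
  record
  { noUnary = λ
      { here → s≤s (s≤s z≤n)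
      ; (there (here refl) p) → noUnary P₁ p
      ; (there (there (here refl)) p) → noUnary P₂ p
      }
  ; unique = UniqueLabels-node₂ (unique P₁) (unique P₂) λ a∈₁ a∈₂ →
      0≢1+n (disjoint zero (suc zero) _ (leaves⁻ P₁ a∈₁) (leaves⁻ P₂ a∈₂))
  ; leaves⁺ = λ a∈S → let i , a∈Cᵢ = to (cover _) a∈S in in-node i (leaves⁺ (child i) a∈Cᵢ)
  ; leaves⁻ = λ { (in-node i a∈) → from (cover _) (i , leaves⁻ (child i) a∈) }
  ; separates = separates′
  }
  where
  P₁ : PhyloDisplaying R C₁ t₁
  P₁ = BinaryBuild⇒PhyloDisplaying b₁
  P₂ : PhyloDisplaying R C₂ t₂
  P₂ = BinaryBuild⇒PhyloDisplaying b₂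
  child : (i : Fin 2) → PhyloDisplaying R (lookup (C₁ ∷ C₂ ∷ []) i) (lookup (t₁ ∷ t₂ ∷ []) i)
  child zero = P₁
  child (suc zero) = P₂
  separates′ : ∀ {r} → r ∈ R → x r ∈ S → y r ∈ S → z r ∈ S →
    Separates (node (t₁ ∷ t₂ ∷ [])) (x r) (y r) (z r)
  separates′ {r} r∈R x∈S y∈S z∈S with to (cover _) x∈S | to (cover _) y∈S | to (cover _) z∈S
  ... | i , x∈Cᵢ | j , y∈Cⱼ | l , z∈Cₗ
    with refl ← closed i j _ _ x∈Cᵢ y∈Cⱼ (x∈S , y∈S , r , r∈R , inj₁ (refl , refl) , z∈S)
    with i ≟ᶠ l
  ... | yes refl = sep-there i (separates (child i) r∈R x∈Cᵢ y∈Cⱼ z∈Cₗ)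
  ... | no i≢l = sep-here i (leaves⁺ (child i) x∈Cᵢ) (leaves⁺ (child i) y∈Cⱼ)
                   λ z∈tᵢ → i≢l (disjoint i l _ (leaves⁻ (child i) z∈tᵢ) z∈Cₗ)

-- Uniqueness of the tree displaying R

Separates-same-child : ∀ {ts a b c} → UniqueLabels (node ts) → Separates (node ts) a b c →
  (k : Fin (length ts)) → a ∈ₜ lookup ts k → b ∈ₜ lookup ts k
Separates-same-child U (sep-here l a∈ b∈ _) k a∈k with refl ← child-unique U k l a∈k a∈ = b∈
Separates-same-child U (sep-there l s) k a∈k with refl ← child-unique U k l a∈k (Separates-∈ₜ s) =
  Separates-∈ₜ (Separates-swap s)

Separates-child : ∀ {ts a b c} → UniqueLabels (node ts) → Separates (node ts) a b c →
  (k : Fin (length ts)) → a ∈ₜ lookup ts k → c ∈ₜ lookup ts k → Separates (lookup ts k) a b c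
Separates-child U (sep-here l a∈ _ c∉) k a∈k c∈k with refl ← child-unique U k l a∈k a∈ = ⊥-elim (c∉ c∈k)
Separates-child U (sep-there l s) k a∈k c∈k with refl ← child-unique U k l a∈k (Separates-∈ₜ s) = s

Adj⇒Separates : ∀ {R S t a b} → PhyloDisplaying R S t → Adj R S a b → ∃ λ c → Separates t a b c
Adj⇒Separates P (a∈ , b∈ , r , r∈R , inj₁ (refl , refl) , z∈) = z r , separates P r∈R a∈ b∈ z∈
Adj⇒Separates P (a∈ , b∈ , r , r∈R , inj₂ (refl , refl) , z∈) =
  z r , Separates-swap (separates P r∈R b∈ a∈ z∈)

PathIn-same-child : ∀ {R S C ts a b} → PhyloDisplaying R S (node ts) → (k : Fin (length ts)) →
  PathIn R S C a b → a ∈ₜ lookup ts k → b ∈ₜ lookup ts k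
PathIn-same-child P k p-refl a∈k = a∈k
PathIn-same-child P k (p-step adj _ path) a∈k =
  PathIn-same-child P k path (Separates-same-child (unique P) (proj₂ (Adj⇒Separates P adj)) k a∈k)

≅ᵇ-leaf-case : ∀ {R S a u} → (∀ b → b ∈ S → b ≡ a) → PhyloDisplaying R S u → leaf a ≅ᵇ u
≅ᵇ-leaf-case {u = leaf b} single P with refl ← single b (leaves⁻ P in-leaf) = ≅ᵇ-leaf
-- Every child of the root contains the only leaf a, so the root would have at most one child.
≅ᵇ-leaf-case {a = a} {u = node us} single P = ⊥-elim (≤⇒≯ (injective⇒≤ all-equal) (noUnary P here))
  where
  a∈child : (k : Fin (length us)) → a ∈ₜ lookup us k
  a∈child k with NoUnary⇒leaf (lookup us k) (NoUnary-child (noUnary P) k)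
  ... | b , b∈k = subst (_∈ₜ lookup us k) (single b (leaves⁻ P (in-node k b∈k))) b∈k
  all-equal : Injective _≡_ _≡_ (λ (_ : Fin (length us)) → zero {n = 0})
  all-equal {k} {l} _ = child-unique (unique P) k l (a∈child k) (a∈child l)

module TwoComponents {R S C₁ C₂ us} (comps : Components R S (C₁ ∷ C₂ ∷ []))
  (P : PhyloDisplaying R S (node us)) where

  Cs : List (List ℕ)
  Cs = C₁ ∷ C₂ ∷ []

  cover : ∀ a → a ∈ S ⇔ (∃ λ (i : Fin 2) → a ∈ lookup Cs i)
  cover = proj₁ (proj₂ comps)

  connected : ∀ i a b → a ∈ lookup Cs i → b ∈ lookup Cs i → PathIn R S (lookup Cs i) a b
  connected = proj₁ (proj₂ (proj₂ (proj₂ comps)))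

  component⊆child : ∀ i k {a b} → a ∈ lookup Cs i → a ∈ₜ lookup us k → b ∈ lookup Cs i → b ∈ₜ lookup us k
  component⊆child i k a∈Cᵢ a∈k b∈Cᵢ = PathIn-same-child P k (connected i _ _ a∈Cᵢ b∈Cᵢ) a∈k

  child-meets-component : ∀ k → ∃₂ λ i a → a ∈ lookup Cs i × a ∈ₜ lookup us k
  child-meets-component k with NoUnary⇒leaf (lookup us k) (NoUnary-child (noUnary P) k)
  ... | a , a∈k = let i , a∈Cᵢ = to (cover a) (leaves⁻ P (in-node k a∈k)) in i , a , a∈Cᵢ , a∈k

  componentOf : Fin (length us) → Fin 2
  componentOf k = proj₁ (child-meets-component k)

  child-unique-in-component : ∀ {i k l a b} →
    a ∈ lookup Cs i → a ∈ₜ lookup us k → b ∈ lookup Cs i → b ∈ₜ lookup us l → k ≡ l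
  child-unique-in-component {i} {k} {l} a∈Cᵢ a∈k b∈Cᵢ b∈l =
    child-unique (unique P) k l a∈k (component⊆child i l b∈Cᵢ b∈l a∈Cᵢ)

  componentOf-injective : Injective _≡_ _≡_ componentOf
  componentOf-injective {k} {l} eq =
    let _ , _ , a∈Cᵢ , a∈k = child-meets-component k
        _ , _ , b∈Cⱼ , b∈l = child-meets-component l
    in child-unique-in-component {componentOf k} a∈Cᵢ a∈k (subst (λ i → _ ∈ lookup Cs i) (sym eq) b∈Cⱼ) b∈l

  children≡2 : length us ≡ 2
  children≡2 = ≤-antisym (injective⇒≤ componentOf-injective) (noUnary P here)

  child-PhyloDisplaying : (∀ i → ∃ λ k → componentOf k ≡ i) →
    ∀ k → PhyloDisplaying R (lookup Cs (componentOf k)) (lookup us k)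
  child-PhyloDisplaying onto k = record
    { noUnary = NoUnary-child (noUnary P) k
    ; unique = UniqueLabels-child (unique P) k
    ; leaves⁺ = leaves⁺′
    ; leaves⁻ = leaves⁻′
    ; separates = λ r∈R x∈ y∈ z∈ →
        Separates-child (unique P) (separates P r∈R (∈S x∈) (∈S y∈) (∈S z∈)) k (leaves⁺′ x∈) (leaves⁺′ z∈)
    }
    where
    ∈S : ∀ {a} → a ∈ lookup Cs (componentOf k) → a ∈ S
    ∈S a∈ = from (cover _) (componentOf k , a∈)
    leaves⁺′ : ∀ {a} → a ∈ lookup Cs (componentOf k) → a ∈ₜ lookup us k
    leaves⁺′ = let _ , _ , b∈C , b∈k = child-meets-component k in component⊆child (componentOf k) k b∈C b∈k
    leaves⁻′ : ∀ {a} → a ∈ₜ lookup us k → a ∈ lookup Cs (componentOf k)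
    leaves⁻′ {a} a∈k with to (cover a) (leaves⁻ P (in-node k a∈k))
    ... | i , a∈Cᵢ with onto i
    ... | l , refl =
      let _ , _ , b∈C , b∈l = child-meets-component l
          k≡l = child-unique-in-component {componentOf l} a∈Cᵢ a∈k b∈C b∈l
      in subst (λ m → a ∈ lookup Cs (componentOf m)) (sym k≡l) a∈Cᵢ

Fin2-surjective : (f : Fin 2 → Fin 2) → Injective _≡_ _≡_ f → ∀ i → ∃ λ k → f k ≡ i
Fin2-surjective f inj with f zero in e₀ | f (suc zero) in e₁
... | zero | zero = ⊥-elim (0≢1+n (inj (trans e₀ (sym e₁))))
... | suc zero | suc zero = ⊥-elim (0≢1+n (inj (trans e₀ (sym e₁))))
... | zero | suc zero = λ { zero → zero , e₀ ; (suc zero) → suc zero , e₁ }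
... | suc zero | zero = λ { zero → suc zero , e₁ ; (suc zero) → zero , e₀ }

≅ᵇ-permuted : ∀ {t₁ t₂ u₁ u₂} (σ : Fin 2 → Fin 2) → Injective _≡_ _≡_ σ →
  (∀ k → lookup (t₁ ∷ t₂ ∷ []) (σ k) ≅ᵇ lookup (u₁ ∷ u₂ ∷ []) k) →
  node (t₁ ∷ t₂ ∷ []) ≅ᵇ node (u₁ ∷ u₂ ∷ [])
≅ᵇ-permuted σ inj match with σ zero in e₀ | σ (suc zero) in e₁ | match zero | match (suc zero)
... | zero | zero | _ | _ = ⊥-elim (0≢1+n (inj (trans e₀ (sym e₁))))
... | suc zero | suc zero | _ | _ = ⊥-elim (0≢1+n (inj (trans e₀ (sym e₁))))
... | zero | suc zero | t₁≅u₁ | t₂≅u₂ = ≅ᵇ-node t₁≅u₁ t₂≅u₂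
... | suc zero | zero | t₂≅u₁ | t₁≅u₂ = ≅ᵇ-swap t₁≅u₂ t₂≅u₁

≅ᵇ-node-case : ∀ {R S C₁ C₂ t₁ t₂} → Components R S (C₁ ∷ C₂ ∷ []) →
  (∀ i {u} → PhyloDisplaying R (lookup (C₁ ∷ C₂ ∷ []) i) u → lookup (t₁ ∷ t₂ ∷ []) i ≅ᵇ u) →
  ∀ {u} → PhyloDisplaying R S u → node (t₁ ∷ t₂ ∷ []) ≅ᵇ u
≅ᵇ-node-case {C₁ = C₁} {C₂} (nonempty , cover , disjoint , _) _ {leaf b} P =
  ⊥-elim (0≢1+n (disjoint zero (suc zero) b (b∈ zero) (b∈ (suc zero))))
  where
  b∈ : ∀ i → b ∈ lookup (C₁ ∷ C₂ ∷ []) i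
  b∈ i = let c , c∈Cᵢ = nonempty i in
    subst (λ d → d ∈ lookup (C₁ ∷ C₂ ∷ []) i) (∈ₜ-leaf (leaves⁺ P (from (cover c) (i , c∈Cᵢ)))) c∈Cᵢ
≅ᵇ-node-case comps _ {node []} P with () ← TwoComponents.children≡2 comps P
≅ᵇ-node-case comps _ {node (_ ∷ [])} P with () ← TwoComponents.children≡2 comps P
≅ᵇ-node-case comps _ {node (_ ∷ _ ∷ _ ∷ _)} P with () ← TwoComponents.children≡2 comps P
≅ᵇ-node-case comps ih {node (_ ∷ _ ∷ [])} P = ≅ᵇ-permuted componentOf componentOf-injective λ k →
  ih (componentOf k) (child-PhyloDisplaying (Fin2-surjective componentOf componentOf-injective) k)
  where open TwoComponents comps P

BinaryBuild-unique : ∀ {R S T u} → BinaryBuild R S T → PhyloDisplaying R S u → T ≅ᵇ u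
BinaryBuild-unique (leaf _ single) = ≅ᵇ-leaf-case single
BinaryBuild-unique (node comps b₁ b₂) = ≅ᵇ-node-case comps λ
  { zero → BinaryBuild-unique b₁
  ; (suc zero) → BinaryBuild-unique b₂
  }

-- Strict density of the closure

∉-sibling : ∀ {ts a} → UniqueLabels (node ts) → (k l : Fin (length ts)) → k ≢ l →
  a ∈ₜ lookup ts l → ¬ a ∈ₜ lookup ts k
∉-sibling U k l k≢l a∈l a∈k = k≢l (child-unique U k l a∈k a∈l)

Binary-resolves : ∀ {t a b c} → Binary t → UniqueLabels t → a ∈ₜ t → b ∈ₜ t → c ∈ₜ t → a ≢ b →
  Separates t a b c ⊎ Separates t a c b ⊎ Separates t b c a
Binary-resolves leaf _ in-leaf in-leaf _ a≢b = ⊥-elim (a≢b refl)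
Binary-resolves (node bin₁ _) U (in-node zero a∈) (in-node zero b∈) (in-node zero c∈) a≢b =
  Sum.map (sep-there zero) (Sum.map (sep-there zero) (sep-there zero))
    (Binary-resolves bin₁ (UniqueLabels-child U zero) a∈ b∈ c∈ a≢b)
Binary-resolves (node _ bin₂) U (in-node (suc zero) a∈) (in-node (suc zero) b∈) (in-node (suc zero) c∈) a≢b =
  Sum.map (sep-there (suc zero)) (Sum.map (sep-there (suc zero)) (sep-there (suc zero)))
    (Binary-resolves bin₂ (UniqueLabels-child U (suc zero)) a∈ b∈ c∈ a≢b)
Binary-resolves (node _ _) U (in-node zero a∈) (in-node zero b∈) (in-node (suc zero) c∈) _ =
  inj₁ (sep-here zero a∈ b∈ (∉-sibling U zero (suc zero) (λ ()) c∈))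
Binary-resolves (node _ _) U (in-node zero a∈) (in-node (suc zero) b∈) (in-node zero c∈) _ =
  inj₂ (inj₁ (sep-here zero a∈ c∈ (∉-sibling U zero (suc zero) (λ ()) b∈)))
Binary-resolves (node _ _) U (in-node (suc zero) a∈) (in-node zero b∈) (in-node zero c∈) _ =
  inj₂ (inj₂ (sep-here zero b∈ c∈ (∉-sibling U zero (suc zero) (λ ()) a∈)))
Binary-resolves (node _ _) U (in-node (suc zero) a∈) (in-node (suc zero) b∈) (in-node zero c∈) _ =
  inj₁ (sep-here (suc zero) a∈ b∈ (∉-sibling U (suc zero) zero (λ ()) c∈))
Binary-resolves (node _ _) U (in-node (suc zero) a∈) (in-node zero b∈) (in-node (suc zero) c∈) _ =
  inj₂ (inj₁ (sep-here (suc zero) a∈ c∈ (∉-sibling U (suc zero) zero (λ ()) b∈)))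
Binary-resolves (node _ _) U (in-node zero a∈) (in-node (suc zero) b∈) (in-node (suc zero) c∈) _ =
  inj₂ (inj₂ (sep-here (suc zero) b∈ c∈ (∉-sibling U (suc zero) zero (λ ()) a∈)))

Separates-exclusive : ∀ {t a b c} → UniqueLabels t → Separates t a b c → ¬ Separates t a c b
Separates-exclusive U (sep-here k a∈ _ c∉) (sep-here l a∈′ c∈ _)
  with refl ← child-unique U k l a∈ a∈′ = c∉ c∈
Separates-exclusive U (sep-here k a∈ _ c∉) (sep-there l s)
  with refl ← child-unique U k l a∈ (Separates-∈ₜ s) = c∉ (Separates-∈ₜ (Separates-swap s))
Separates-exclusive U (sep-there k s) (sep-here l a∈ _ b∉)
  with refl ← child-unique U k l (Separates-∈ₜ s) a∈ = b∉ (Separates-∈ₜ (Separates-swap s))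
Separates-exclusive U (sep-there k s) (sep-there l s′)
  with refl ← child-unique U k l (Separates-∈ₜ s) (Separates-∈ₜ s′) =
  Separates-exclusive (UniqueLabels-child U k) s s′

Cherry : Triple → ℕ → ℕ → Set
Cherry r a b = (a ≡ x r × b ≡ y r) ⊎ (a ≡ y r × b ≡ x r)

SameLeaves : Triple → Triple → Set
SameLeaves r r′ = ∀ w → InLeaves w r ⇔ InLeaves w r′

Cherry-swap : ∀ {r a b} → Cherry r a b → Cherry r b a
Cherry-swap (inj₁ (a≡x , b≡y)) = inj₂ (b≡y , a≡x)
Cherry-swap (inj₂ (a≡y , b≡x)) = inj₁ (b≡x , a≡y)

Cherry-InLeaves : ∀ {r a b} → Cherry r a b → InLeaves a r
Cherry-InLeaves (inj₁ (a≡x , _)) = inj₁ a≡x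
Cherry-InLeaves (inj₂ (a≡y , _)) = inj₂ (inj₁ a≡y)

Cherry-≢ : ∀ {r a b} → Cherry r a b → a ≢ b
Cherry-≢ {r} (inj₁ (refl , refl)) = x≢y r
Cherry-≢ {r} (inj₂ (refl , refl)) = x≢y r ∘ sym

Cherry-≢z : ∀ {r a b} → Cherry r a b → a ≢ z r
Cherry-≢z {r} (inj₁ (refl , _)) = x≢z r
Cherry-≢z {r} (inj₂ (refl , _)) = y≢z r

InLeaves-Cherry : ∀ {r a} → InLeaves a r → a ≢ z r → ∃ λ b → Cherry r b a
InLeaves-Cherry {r} (inj₁ refl) _ = y r , inj₂ (refl , refl)
InLeaves-Cherry {r} (inj₂ (inj₁ refl)) _ = x r , inj₁ (refl , refl)
InLeaves-Cherry (inj₂ (inj₂ refl)) a≢z = ⊥-elim (a≢z refl)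

Cherry-InLeaves⁻ : ∀ {r a b w} → Cherry r a b → InLeaves w r → w ≡ a ⊎ w ≡ b ⊎ w ≡ z r
Cherry-InLeaves⁻ (inj₁ (refl , refl)) w∈ = w∈
Cherry-InLeaves⁻ (inj₂ (refl , refl)) (inj₁ w≡x) = inj₂ (inj₁ w≡x)
Cherry-InLeaves⁻ (inj₂ (refl , refl)) (inj₂ (inj₁ w≡y)) = inj₁ w≡y
Cherry-InLeaves⁻ (inj₂ (refl , refl)) (inj₂ (inj₂ w≡z)) = inj₂ (inj₂ w≡z)

Separates-Cherry : ∀ {t r a b} → Separates t (x r) (y r) (z r) → Cherry r a b → Separates t a b (z r)
Separates-Cherry s (inj₁ (refl , refl)) = s
Separates-Cherry s (inj₂ (refl , refl)) = Separates-swap s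

Separates⇒outgroup≡ : ∀ {t r r′} → UniqueLabels t → Separates t (x r) (y r) (z r) →
  Separates t (x r′) (y r′) (z r′) → SameLeaves r r′ → z r ≡ z r′
Separates⇒outgroup≡ {r = r} {r′} U s s′ shared with z r ≟ℕ z r′
... | yes z≡z′ = z≡z′
... | no z≢z′
  with w , w-cherry ← InLeaves-Cherry {r} (from (shared _) (inj₂ (inj₂ refl))) (z≢z′ ∘ sym)
     | w′ , w′-cherry ← InLeaves-Cherry {r′} (to (shared _) (inj₂ (inj₂ refl))) z≢z′
  with Cherry-InLeaves⁻ {r′} w′-cherry (to (shared w) (Cherry-InLeaves {r} w-cherry))
... | inj₁ refl =
  ⊥-elim (Separates-exclusive U (Separates-Cherry {r = r} s w-cherry) (Separates-Cherry {r = r′} s′ w′-cherry))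
... | inj₂ (inj₁ w≡z) = ⊥-elim (Cherry-≢z {r} w-cherry w≡z)
... | inj₂ (inj₂ w≡z′) = ⊥-elim (Cherry-≢ {r} w-cherry w≡z′)

same-outgroup⇒≈t : ∀ {r r′} → SameLeaves r r′ → z r ≡ z r′ → r ≈t r′
same-outgroup⇒≈t {r} {r′} shared z≡z′
  with b , b-cherry ← InLeaves-Cherry {r′} (to (shared _) (inj₁ refl)) (x≢z r ∘ λ x≡z′ → trans x≡z′ (sym z≡z′))
  with Cherry-InLeaves⁻ {r′} b-cherry (to (shared _) (inj₂ (inj₁ refl)))
... | inj₁ refl = z≡z′ , Cherry-swap {r′} b-cherry
... | inj₂ (inj₁ y≡x) = ⊥-elim (x≢y r (sym y≡x))
... | inj₂ (inj₂ y≡z′) = ⊥-elim (y≢z r (trans y≡z′ (sym z≡z′)))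

Separates⇒≈t : ∀ {t r r′} → UniqueLabels t → Separates t (x r) (y r) (z r) →
  Separates t (x r′) (y r′) (z r′) → SameLeaves r r′ → r ≈t r′
Separates⇒≈t {r = r} {r′} U s s′ shared =
  same-outgroup⇒≈t {r} {r′} shared (Separates⇒outgroup≡ {r = r} {r′} U s s′ shared)

leavesOf-∈ : ∀ {R r w} → r ∈ R → InLeaves w r → w ∈ leavesOf R
leavesOf-∈ (here refl) (inj₁ refl) = here refl
leavesOf-∈ (here refl) (inj₂ (inj₁ refl)) = there (here refl)
leavesOf-∈ (here refl) (inj₂ (inj₂ refl)) = there (there (here refl))
leavesOf-∈ (there r∈R) w∈r = there (there (there (leavesOf-∈ r∈R w∈r)))

IsPhylo⇒PhyloDisplaying : ∀ {R t} → IsPhylo t (leavesOf R) → DisplaysAll t R →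
  PhyloDisplaying R (leavesOf R) t
IsPhylo⇒PhyloDisplaying (noUnary′ , leaves , unique′) displays = record
  { noUnary = noUnary′
  ; unique = unique′
  ; leaves⁺ = λ a∈ → let p , e = to (leaves _) a∈ in labelled⇒∈ₜ p e
  ; leaves⁻ = λ a∈ → from (leaves _) (∈ₜ⇒labelled a∈)
  ; separates = λ {r} r∈R _ _ _ → Displays⇒Separates r (displays r r∈R)
  }

PhyloDisplaying⇒IsPhylo : ∀ {R S t} → PhyloDisplaying R S t → IsPhylo t S
PhyloDisplaying⇒IsPhylo P =
  noUnary P , (λ _ → mk⇔ (∈ₜ⇒labelled ∘ leaves⁺ P) (λ (p , e) → leaves⁻ P (labelled⇒∈ₜ p e))) , unique P

PhyloDisplaying⇒DisplaysAll : ∀ {R t} → PhyloDisplaying R (leavesOf R) t → DisplaysAll t R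
PhyloDisplaying⇒DisplaysAll {R} P r r∈R =
  Separates⇒Displays r (unique P) (leaves⁺ P x∈) (leaves⁺ P y∈) (leaves⁺ P z∈) (separates P r∈R x∈ y∈ z∈)
  where
  x∈ : x r ∈ leavesOf R
  x∈ = leavesOf-∈ r∈R (inj₁ refl)
  y∈ : y r ∈ leavesOf R
  y∈ = leavesOf-∈ r∈R (inj₂ (inj₁ refl))
  z∈ : z r ∈ leavesOf R
  z∈ = leavesOf-∈ r∈R (inj₂ (inj₂ refl))

Separates⇒InCl : ∀ {R T} → BinaryBuild R (leavesOf R) T → ∀ r →
  x r ∈ leavesOf R → y r ∈ leavesOf R → z r ∈ leavesOf R → Separates T (x r) (y r) (z r) → InCl R r
Separates⇒InCl {R} build r x∈ y∈ z∈ s T′ phylo displays =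
  Separates⇒Displays r (unique P′) (leaves⁺ P′ x∈) (leaves⁺ P′ y∈) (leaves⁺ P′ z∈)
    (≅ᵇ-Separates (BinaryBuild-unique build P′) s)
  where
  P′ : PhyloDisplaying R (leavesOf R) T′
  P′ = IsPhylo⇒PhyloDisplaying phylo displays

rotate : ∀ {A B C : Set} → A ⊎ B ⊎ C → B ⊎ C ⊎ A
rotate = assocʳ ∘ swap

InCl-strictlyDense : ∀ {R T} → BinaryBuild R (leavesOf R) T → Binary T →
  StrictlyDense (InCl R) (leavesOf R)
InCl-strictlyDense {R} {T} build bin a b c a∈ b∈ c∈ a≢b a≢c b≢c =
  existence (Binary-resolves bin (unique P) (leaves⁺ P a∈) (leaves⁺ P b∈) (leaves⁺ P c∈) a≢b) , uniqueness
  where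
  P : PhyloDisplaying R (leavesOf R) T
  P = BinaryBuild⇒PhyloDisplaying build
  witness : ∀ r → x r ∈ leavesOf R → y r ∈ leavesOf R → z r ∈ leavesOf R →
    Separates T (x r) (y r) (z r) → OnLeaves r a b c → Σ Triple λ r → InCl R r × OnLeaves r a b c
  witness r x∈ y∈ z∈ s on = r , Separates⇒InCl build r x∈ y∈ z∈ s , on
  existence : Separates T a b c ⊎ Separates T a c b ⊎ Separates T b c a →
    Σ Triple λ r → InCl R r × OnLeaves r a b c
  existence (inj₁ s) =
    witness (mkTriple a b c a≢b a≢c b≢c) a∈ b∈ c∈ s λ _ → mk⇔ id id
  existence (inj₂ (inj₁ s)) =
    witness (mkTriple a c b a≢c a≢b (b≢c ∘ sym)) a∈ c∈ b∈ s λ _ → mk⇔ (map₂ swap) (map₂ swap)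
  existence (inj₂ (inj₂ s)) =
    witness (mkTriple b c a b≢c (a≢b ∘ sym) (a≢c ∘ sym)) b∈ c∈ a∈ s λ _ → mk⇔ (rotate ∘ rotate) rotate
  InCl⇒Separates : ∀ {r} → InCl R r → Separates T (x r) (y r) (z r)
  InCl⇒Separates {r} r∈cl =
    Displays⇒Separates r (r∈cl T (PhyloDisplaying⇒IsPhylo P) (PhyloDisplaying⇒DisplaysAll P))
  uniqueness : ∀ r r′ → InCl R r → InCl R r′ → OnLeaves r a b c → OnLeaves r′ a b c → r ≈t r′
  uniqueness r r′ r∈cl r′∈cl on on′ =
    Separates⇒≈t {r = r} {r′} (unique P) (InCl⇒Separates {r} r∈cl) (InCl⇒Separates {r′} r′∈cl)
      λ w → mk⇔ (from (on′ w) ∘ to (on w)) (from (on w) ∘ to (on′ w))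

proposition1 : (R : List Triple) → Consistent R → (T : Tree) → IsAho R T → IsBinary T →
    StrictlyDense (InCl R) (leavesOf R) ×
    (IsPhylo T (leavesOf R) × DisplaysAll T R ×
      (∀ T' → IsPhylo T' (leavesOf R) → DisplaysAll T' R → T ≅ T')) ×
    (∀ T' → IsPhylo T' (leavesOf R) → DisplaysAll T' R → innerCount T ≤ innerCount T')
proposition1 R _ T aho isBinary =
  InCl-strictlyDense build bin ,
  (PhyloDisplaying⇒IsPhylo P , PhyloDisplaying⇒DisplaysAll P , λ _ phylo displays → ≅ᵇ⇒≅ (≅ᵇ-any phylo displays)) ,
  λ _ phylo displays → ≤-reflexive (innerCount-≅ᵇ (≅ᵇ-any phylo displays))
  where
  bin : Binary T
  bin = IsBinary⇒Binary T isBinary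
  build : BinaryBuild R (leavesOf R) T
  build = Build⇒BinaryBuild aho bin
  P : PhyloDisplaying R (leavesOf R) T
  P = BinaryBuild⇒PhyloDisplaying build
  ≅ᵇ-any : ∀ {T′} → IsPhylo T′ (leavesOf R) → DisplaysAll T′ R → T ≅ᵇ T′
  ≅ᵇ-any phylo displays = BinaryBuild-unique build (IsPhylo⇒PhyloDisplaying phylo displays)
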